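{- Let $n\geq 2$ be an integer and $G_n=K_2\square K_2\square K_n$. Then $\mathrm{rn}(G_n)=6n-1$.
   Context: $K_n$ is the complete graph on $n$ vertices and $\square$ the Cartesian product of graphs. For a simple connected graph $G$, a map $f:V(G)\to\mathbb{Z}_+$ is a radio labeling if $|f(u)-f(v)|\geq \mathrm{diam}(G)+1-d(u,v)$ for all distinct $u,v\in V(G)$; its span is the largest value of $f$, and the radio number $\mathrm{rn}(G)$ is the minimum span over all radio labelings of $G$. -}

module Defs where

open import Data.Nat using (ℕ; zero; suc; _+_; _≤_; _<_; ∣_-_∣)
open import Data.Fin using (Fin)
open import Data.Product using (Σ; _×_; ∃-syntax)
open import Data.Sum using (_⊎_)
open import Relation.Nullary using (¬_)
open import Relation.Binary.PropositionalEquality using (_≡_; _≢_)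

record Graph : Set₁ where
  field
    Vertex : Set
    Adj    : Vertex → Vertex → Set
open Graph public

K : ℕ → Graph
K m = record { Vertex = Fin m ; Adj = λ u v → u ≢ v }

_□_ : Graph → Graph → Graph
G □ H = record
  { Vertex = Vertex G × Vertex H
  ; Adj = λ p q →
      (Adj G (Data.Product.proj₁ p) (Data.Product.proj₁ q) × Data.Product.proj₂ p ≡ Data.Product.proj₂ q)
      ⊎ (Data.Product.proj₁ p ≡ Data.Product.proj₁ q × Adj H (Data.Product.proj₂ p) (Data.Product.proj₂ q))
  }
infixr 6 _□_

data Walk (G : Graph) : Vertex G → Vertex G → ℕ → Set where
  here : ∀ {u} → Walk G u u 0
  step : ∀ {u w v k} → Adj G u w → Walk G w v k → Walk G u v (suc k)

IsDist : (G : Graph) → Vertex G → Vertex G → ℕ → Set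
IsDist G u v k = Walk G u v k × (∀ j → j < k → ¬ Walk G u v j)

IsDiam : (G : Graph) → ℕ → Set
IsDiam G D =
  (∀ u v → ∃[ k ] (k ≤ D × IsDist G u v k))
  × ∃[ u ] ∃[ v ] IsDist G u v D

IsRadioLabeling : (G : Graph) → ℕ → (Vertex G → ℕ) → Set
IsRadioLabeling G D f =
  (∀ v → 1 ≤ f v)
  × (∀ u v → u ≢ v → ∀ k → IsDist G u v k → D + 1 ≤ ∣ f u - f v ∣ + k)

HasSpan : (G : Graph) → (Vertex G → ℕ) → ℕ → Set
HasSpan G f s = (∀ v → f v ≤ s) × ∃[ v ] (f v ≡ s)

IsRadioNumber : (G : Graph) → ℕ → ℕ → Set
IsRadioNumber G D r =
  (∃[ f ] (IsRadioLabeling G D f × HasSpan G f r))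
  × (∀ f → IsRadioLabeling G D f → ∃[ v ] (r ≤ f v))

Gn : ℕ → Graph
Gn n = K 2 □ K 2 □ K n

module Submission where

-- The distance in G_n = K₂ □ K₂ □ K_n is the Hamming distance of the coordinates, so the diameter
-- is 3 and a radio labeling only constrains labels at most two apart: labels one apart need
-- distance 3 and labels two apart need distance at least 2.  Vertices with consecutive labels
-- therefore differ in both K₂-coordinates, so no three labels are consecutive, and 4n such labels
-- do not fit into [1, 6n − 2], which has room for only 4n − 1 of them.  Conversely, the labels
-- 3 τ_a(w) + a + 1 on the vertices (a, w), for suitable enumerations τ₀, τ₁ of K₂ □ K_n by
-- {0, …, 2n − 1}, meet these constraints and reach 6n − 1.

open import Defs
open import Data.Nat
  using (ℕ; suc; _+_; _*_; _∸_; _≤_; _<_; z≤n; s≤s; s≤s⁻¹; ∣_-_∣; pred; _≤?_; NonZero)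
open import Data.Nat.Properties hiding (_≟_)
import Data.Nat.Properties as ℕ
open import Data.Nat.DivMod using (_%_; _divMod_; DivMod; result; m<n⇒m%n≡m; [m+kn]%n≡m%n)
open import Data.Nat.Tactic.RingSolver using (solve-∀)
open import Data.Fin using (Fin; toℕ; fromℕ<; remQuot; combine)
import Data.Fin as Fin
open import Data.Fin.Patterns using (0F; 1F; 2F)
open import Data.Fin.Properties
  using (_≟_; any?; toℕ-injective; toℕ<n; fromℕ<-injective; injective⇒≤; combine-remQuot)
open import Data.Product using (_×_; _,_; proj₁; proj₂; ∃-syntax; map₂; uncurry)
open import Data.Sum using (inj₁; inj₂; [_,_]′)
open import Data.Empty using (⊥; ⊥-elim)
open import Function using (_∘_)
open import Relation.Nullary using (¬_; yes; no)
open import Relation.Unary using (Decidable)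
open import Relation.Binary.PropositionalEquality

-- Graph distances and the radio condition

walk₀⇒≡ : ∀ {G u v} → Walk G u v 0 → u ≡ v
walk₀⇒≡ here = refl

isDist-unique : ∀ {G u v k l} → IsDist G u v k → IsDist G u v l → k ≡ l
isDist-unique {k = k} {l} (p , p-shortest) (q , q-shortest) =
  ≤-antisym (≮⇒≥ λ l<k → p-shortest l l<k q) (≮⇒≥ λ k<l → q-shortest k k<l p)

isDiam-unique : ∀ {G D D′} → IsDiam G D → IsDiam G D′ → D ≡ D′
isDiam-unique d d′ = ≤-antisym (diam≤ d d′) (diam≤ d′ d)
  where
  diam≤ : ∀ {G D D′} → IsDiam G D → IsDiam G D′ → D ≤ D′
  diam≤ (_ , u , v , isDist) (all′ , _) with all′ u v
  ... | k , k≤D′ , isDist′ = subst (_≤ _) (sym (isDist-unique isDist isDist′)) k≤D′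

RadioCondition : {V : Set} → ℕ → (V → V → ℕ) → (V → ℕ) → Set
RadioCondition D d f = ∀ u v → u ≢ v → D + 1 ≤ ∣ f u - f v ∣ + d u v

∣m-n+m∣≡n : ∀ m n → ∣ m - n + m ∣ ≡ n
∣m-n+m∣≡n m n = trans (cong (λ x → ∣ m - x ∣) (+-comm n m)) (∣m-m+n∣≡n m n)

radioCondition-pred : ∀ {V : Set} {D d} {f : V → ℕ} → (∀ v → 1 ≤ f v) → RadioCondition D d f →
                      RadioCondition D d (pred ∘ f)
radioCondition-pred {D = D} {d} {f} pos rc u v u≢v =
  subst (λ x → D + 1 ≤ x + d u v) (∣pred-pred∣ (pos u) (pos v)) (rc u v u≢v)
  where
  ∣pred-pred∣ : ∀ {x y} → 1 ≤ x → 1 ≤ y → ∣ x - y ∣ ≡ ∣ pred x - pred y ∣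
  ∣pred-pred∣ (s≤s _) (s≤s _) = refl

record GraphDistance (G : Graph) : Set where
  field
    dist      : Vertex G → Vertex G → ℕ
    walk      : ∀ u v → Walk G u v (dist u v)
    dist-self : ∀ u → dist u u ≡ 0
    dist-sym  : ∀ u v → dist u v ≡ dist v u
    dist-edge : ∀ {u w} v → Adj G u w → dist u v ≤ suc (dist w v)

  dist≤length : ∀ {u v k} → Walk G u v k → dist u v ≤ k
  dist≤length {u} here = ≤-reflexive (dist-self u)
  dist≤length {v = v} (step e p) = ≤-trans (dist-edge v e) (s≤s (dist≤length p))

  isDist : ∀ u v → IsDist G u v (dist u v)
  isDist u v = walk u v , λ j j<dist p → <⇒≱ j<dist (dist≤length p)

  dist-pos : ∀ {u v} → u ≢ v → 1 ≤ dist u v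
  dist-pos {u} {v} u≢v = n≢0⇒n>0 λ dist≡0 → u≢v (walk₀⇒≡ (subst (Walk G u v) dist≡0 (walk u v)))

  radioCondition⇒isRadioLabeling : ∀ {D f} → (∀ v → 1 ≤ f v) → RadioCondition D dist f →
                                   IsRadioLabeling G D f
  radioCondition⇒isRadioLabeling {D} {f} pos rc = pos , λ u v u≢v k isDist′ →
    subst (λ k → D + 1 ≤ ∣ f u - f v ∣ + k) (isDist-unique (isDist u v) isDist′) (rc u v u≢v)

  isRadioLabeling⇒radioCondition : ∀ {D f} → IsRadioLabeling G D f → RadioCondition D dist f
  isRadioLabeling⇒radioCondition (_ , rad) u v u≢v = rad u v u≢v (dist u v) (isDist u v)

  radioCondition-gap : ∀ {D f u v} t → RadioCondition D dist f → f v ≡ suc t + f u →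
                       D + 1 ≤ suc t + dist u v
  radioCondition-gap {D} {f} {u} {v} t rc fv≡ =
    subst (λ x → D + 1 ≤ x + dist u v) gap (rc u v u≢v)
    where
    gap : ∣ f u - f v ∣ ≡ suc t
    gap = trans (cong (λ x → ∣ f u - x ∣) fv≡) (∣m-n+m∣≡n (f u) (suc t))
    u≢v : u ≢ v
    u≢v refl = m≢1+n+m (f u) fv≡

  radioCondition₃-distinct : ∀ {f} → (∀ u v → dist u v ≤ 3) → RadioCondition 3 dist f →
                             ∀ {u v} → u ≢ v → f u ≢ f v
  radioCondition₃-distinct {f} dist≤3 rc {u} {v} u≢v fu≡fv =
    ≤⇒≯ (dist≤3 u v) (subst (λ x → 4 ≤ x + dist u v) (m≡n⇒∣m-n∣≡0 fu≡fv) (rc u v u≢v))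

  radioCondition₃ : ∀ {f} → (∀ {u v} → u ≢ v → f u ≢ f v) →
                    (∀ {u v} → f v ≡ 1 + f u → 3 ≤ dist u v) →
                    (∀ {u v} → f v ≡ 2 + f u → 2 ≤ dist u v) →
                    RadioCondition 3 dist f
  radioCondition₃ {f} distinct gap₁ gap₂ u v u≢v =
    [ oriented u≢v
    , (λ fv≤fu → subst₂ (λ x y → 4 ≤ x + y) (∣-∣-comm (f v) (f u)) (dist-sym v u)
                   (oriented (≢-sym u≢v) fv≤fu))
    ]′ (≤-total (f u) (f v))
    where
    byGap : ∀ {u v} t → u ≢ v → f v ≡ t + f u → 4 ≤ t + dist u v
    byGap 0 u≢v fv≡ = ⊥-elim (distinct u≢v (sym fv≡))
    byGap 1 _ fv≡ = s≤s (gap₁ fv≡)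
    byGap 2 _ fv≡ = s≤s (s≤s (gap₂ fv≡))
    byGap (suc (suc (suc t))) u≢v _ = +-mono-≤ (m≤m+n 3 t) (dist-pos u≢v)

    oriented : ∀ {u v} → u ≢ v → f u ≤ f v → 4 ≤ ∣ f u - f v ∣ + dist u v
    oriented {u} {v} u≢v fu≤fv =
      subst (λ x → 4 ≤ x + dist u v) (sym ∣fu-fv∣≡t) (byGap t u≢v fv≡)
      where
      t = proj₁ (m≤n⇒∃[o]m+o≡n fu≤fv)
      fv≡ : f v ≡ t + f u
      fv≡ = trans (sym (proj₂ (m≤n⇒∃[o]m+o≡n fu≤fv))) (+-comm (f u) t)
      ∣fu-fv∣≡t : ∣ f u - f v ∣ ≡ t
      ∣fu-fv∣≡t = trans (cong (λ x → ∣ f u - x ∣) fv≡) (∣m-n+m∣≡n (f u) t)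

-- Complete graphs and Cartesian products

δ : ∀ {m} → Fin m → Fin m → ℕ
δ x y with x ≟ y
... | yes _ = 0
... | no  _ = 1

δ-refl : ∀ {m} (x : Fin m) → δ x x ≡ 0
δ-refl x with x ≟ x
... | yes _  = refl
... | no x≢x = ⊥-elim (x≢x refl)

δ≤1 : ∀ {m} (x y : Fin m) → δ x y ≤ 1
δ≤1 x y with x ≟ y
... | yes _ = z≤n
... | no  _ = s≤s z≤n

δ-sym : ∀ {m} (x y : Fin m) → δ x y ≡ δ y x
δ-sym x y with x ≟ y | y ≟ x
... | yes _   | yes _   = refl
... | no  _   | no  _   = refl
... | yes x≡y | no  y≢x = ⊥-elim (y≢x (sym x≡y))
... | no  x≢y | yes y≡x = ⊥-elim (x≢y (sym y≡x))

δ-≢ : ∀ {m} {x y : Fin m} → x ≢ y → δ x y ≡ 1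
δ-≢ {x = x} {y} x≢y with x ≟ y
... | yes x≡y = ⊥-elim (x≢y x≡y)
... | no  _   = refl

δ<2 : ∀ {m} (x y : Fin m) → δ x y < 2
δ<2 x y = s≤s (δ≤1 x y)

δ≡0⇒≡ : ∀ {m} {x y : Fin m} → δ x y ≡ 0 → x ≡ y
δ≡0⇒≡ {x = x} {y} eq with x ≟ y
... | yes x≡y = x≡y
δ≡0⇒≡ () | no _

completeDistance : ∀ m → GraphDistance (K m)
completeDistance m = record
  { dist      = δ
  ; walk      = walk
  ; dist-self = δ-refl
  ; dist-sym  = δ-sym
  ; dist-edge = λ {u} v _ → ≤-trans (δ≤1 u v) (s≤s z≤n)
  }
  where
  walk : ∀ x y → Walk (K m) x y (δ x y)
  walk x y with x ≟ y
  ... | yes refl = here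
  ... | no  x≢y  = step x≢y here

module _ {G H : Graph} where

  infixr 5 _++ʷ_
  _++ʷ_ : ∀ {u w v k l} → Walk (G □ H) u w k → Walk (G □ H) w v l → Walk (G □ H) u v (k + l)
  here     ++ʷ q = q
  step e p ++ʷ q = step e (p ++ʷ q)

  liftˡ : ∀ {x x′ k} y → Walk G x x′ k → Walk (G □ H) (x , y) (x′ , y) k
  liftˡ y here       = here
  liftˡ y (step e p) = step (inj₁ (e , refl)) (liftˡ y p)

  liftʳ : ∀ {y y′ k} x → Walk H y y′ k → Walk (G □ H) (x , y) (x , y′) k
  liftʳ x here       = here
  liftʳ x (step e p) = step (inj₂ (refl , e)) (liftʳ x p)

  infixr 6 _□ᵈ_
  _□ᵈ_ : GraphDistance G → GraphDistance H → GraphDistance (G □ H)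
  dG □ᵈ dH = record
    { dist      = dist
    ; walk      = λ (x , y) (x′ , y′) → liftˡ y (G.walk x x′) ++ʷ liftʳ x′ (H.walk y y′)
    ; dist-self = λ (x , y) → cong₂ _+_ (G.dist-self x) (H.dist-self y)
    ; dist-sym  = λ (x , y) (x′ , y′) → cong₂ _+_ (G.dist-sym x x′) (H.dist-sym y y′)
    ; dist-edge = dist-edge
    }
    where
    module G = GraphDistance dG
    module H = GraphDistance dH

    dist : Vertex (G □ H) → Vertex (G □ H) → ℕ
    dist (x , y) (x′ , y′) = G.dist x x′ + H.dist y y′

    dist-edge : ∀ {u w} v → Adj (G □ H) u w → dist u v ≤ suc (dist w v)
    dist-edge (x′ , y′) (inj₁ (e , refl)) = +-monoˡ-≤ _ (G.dist-edge x′ e)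
    dist-edge {x , y} (x′ , y′) (inj₂ (refl , e)) =
      ≤-trans (+-monoʳ-≤ (G.dist x x′) (H.dist-edge y′ e)) (≤-reflexive (+-suc _ _))

GnDistance : ∀ n → GraphDistance (Gn n)
GnDistance n = completeDistance 2 □ᵈ completeDistance 2 □ᵈ completeDistance n

-- Sets of numbers without three consecutive elements

remainder-quotient-unique : ∀ m .{{_ : NonZero m}} {a b j k} → a < m → b < m →
                            a + j * m ≡ b + k * m → a ≡ b × j ≡ k
remainder-quotient-unique m {a} {b} {j} {k} a<m b<m eq =
  a≡b , *-cancelʳ-≡ j k m (+-cancelˡ-≡ a _ _ eq′)
  where
  a≡b : a ≡ b
  a≡b = begin
    a               ≡⟨ sym (m<n⇒m%n≡m a<m) ⟩
    a % m           ≡⟨ sym ([m+kn]%n≡m%n a j m) ⟩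
    (a + j * m) % m ≡⟨ cong (_% m) eq ⟩
    (b + k * m) % m ≡⟨ [m+kn]%n≡m%n b k m ⟩
    b % m           ≡⟨ m<n⇒m%n≡m b<m ⟩
    b               ∎
    where open ≡-Reasoning
  eq′ : a + j * m ≡ a + k * m
  eq′ = trans eq (cong (_+ k * m) (sym a≡b))

NoThreeConsecutive : (ℕ → Set) → Set
NoThreeConsecutive S = ∀ {t} → S t → S (1 + t) → S (2 + t) → ⊥

-- A set without three consecutive elements meets each block {3q, 3q+1, 3q+2} at most twice; the
-- slot of x is 2q plus a bit telling which of the two places of its block x occupies.
module Slots {S : ℕ → Set} (S? : Decidable S) (noThree : NoThreeConsecutive S) where

  bit : Fin 3 → ℕ → ℕ
  bit 0F x = 0
  bit 1F x with S? (pred x)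
  ... | yes _ = 1
  ... | no  _ = 0
  bit 2F x = 1

  bit≤1 : ∀ r x → bit r x ≤ 1
  bit≤1 0F x = z≤n
  bit≤1 1F x with S? (pred x)
  ... | yes _ = s≤s z≤n
  ... | no  _ = z≤n
  bit≤1 2F x = s≤s z≤n

  bit₁≡0⇒∉ : ∀ x → bit 1F (suc x) ≡ 0 → ¬ S x
  bit₁≡0⇒∉ x bit≡0 with S? x
  bit₁≡0⇒∉ x () | yes _
  ... | no x∉S = x∉S

  bit₁≡1⇒∈ : ∀ x → bit 1F (suc x) ≡ 1 → S x
  bit₁≡1⇒∈ x bit≡1 with S? x
  ... | yes x∈S = x∈S
  bit₁≡1⇒∈ x () | no _

  slot : ∀ {x} → DivMod x 3 → ℕ
  slot {x} (result q r _) = bit r x + q * 2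

  sameBlock : ∀ q r r′ → bit r (toℕ r + q * 3) ≡ bit r′ (toℕ r′ + q * 3) →
              S (toℕ r + q * 3) → S (toℕ r′ + q * 3) → toℕ r + q * 3 ≡ toℕ r′ + q * 3
  sameBlock q 0F 0F _  _ _ = refl
  sameBlock q 1F 1F _  _ _ = refl
  sameBlock q 2F 2F _  _ _ = refl
  sameBlock q 0F 2F () _ _
  sameBlock q 2F 0F () _ _
  sameBlock q 0F 1F eq x∈S _ = ⊥-elim (bit₁≡0⇒∉ (q * 3) (sym eq) x∈S)
  sameBlock q 1F 0F eq _ y∈S = ⊥-elim (bit₁≡0⇒∉ (q * 3) eq y∈S)
  sameBlock q 1F 2F eq x∈S y∈S = ⊥-elim (noThree (bit₁≡1⇒∈ (q * 3) eq) x∈S y∈S)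
  sameBlock q 2F 1F eq x∈S y∈S = ⊥-elim (noThree (bit₁≡1⇒∈ (q * 3) (sym eq)) y∈S x∈S)

  slot-injective : ∀ {x y} (dx : DivMod x 3) (dy : DivMod y 3) → S x → S y →
                   slot dx ≡ slot dy → x ≡ y
  slot-injective (result q r refl) (result q′ r′ refl) x∈S y∈S eq
    with remainder-quotient-unique 2 {j = q} {k = q′} (s≤s (bit≤1 r _)) (s≤s (bit≤1 r′ _)) eq
  ... | bits , refl = sameBlock q r r′ bits x∈S y∈S

  slot≤ : ∀ {x} q (dx : DivMod x 3) → x ≤ q * 3 → slot dx ≤ q * 2
  slot≤ q (result Q 0F refl) x≤ = *-monoˡ-≤ 2 (*-cancelʳ-≤ Q q 3 x≤)
  slot≤ q (result Q (Fin.suc r) refl) x≤ = begin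
    bit (Fin.suc r) _ + Q * 2 ≤⟨ +-monoˡ-≤ (Q * 2) (bit≤1 (Fin.suc r) _) ⟩
    1 + Q * 2                 ≤⟨ n≤1+n _ ⟩
    suc Q * 2                 ≤⟨ *-monoˡ-≤ 2 (*-cancelʳ-< 3 Q q Q*3<q*3) ⟩
    q * 2                     ∎
    where
    open ≤-Reasoning
    Q*3<q*3 = ≤-trans (s≤s (m≤n+m _ (toℕ r))) x≤

noThreeConsecutive⇒≤ : ∀ {k} q (g : Fin k → ℕ) → (∀ {i j} → i ≢ j → g i ≢ g j) →
                       NoThreeConsecutive (λ t → ∃[ i ] g i ≡ t) → (∀ i → g i ≤ q * 3) →
                       k ≤ suc (q * 2)
noThreeConsecutive⇒≤ q g distinct noThree g≤ = injective⇒≤ slotIndex-injective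
  where
  open Slots (λ t → any? (λ i → g i ℕ.≟ t)) noThree

  slotIndex : Fin _ → Fin (suc (q * 2))
  slotIndex i = fromℕ< (s≤s (slot≤ q (g i divMod 3) (g≤ i)))

  slotIndex-injective : ∀ {i j} → slotIndex i ≡ slotIndex j → i ≡ j
  slotIndex-injective {i} {j} eq with i ≟ j
  ... | yes i≡j = i≡j
  ... | no  i≢j = ⊥-elim (distinct i≢j
          (slot-injective (g i divMod 3) (g j divMod 3) (i , refl) (j , refl)
            (fromℕ<-injective _ _ _ _ eq)))

-- The lower bound

≢-≢⇒≡ : {x y z : Fin 2} → x ≢ y → y ≢ z → x ≡ z
≢-≢⇒≡ {0F} {0F}      x≢y _   = ⊥-elim (x≢y refl)
≢-≢⇒≡ {1F} {1F}      x≢y _   = ⊥-elim (x≢y refl)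
≢-≢⇒≡ {0F} {1F} {0F} _   _   = refl
≢-≢⇒≡ {1F} {0F} {1F} _   _   = refl
≢-≢⇒≡ {0F} {1F} {1F} _   y≢z = ⊥-elim (y≢z refl)
≢-≢⇒≡ {1F} {0F} {0F} _   y≢z = ⊥-elim (y≢z refl)

module _ {n : ℕ} where
  open GraphDistance (GnDistance n)

  Gn-dist≤3 : ∀ u v → dist u v ≤ 3
  Gn-dist≤3 (a , b , c) (a′ , b′ , c′) = +-mono-≤ (δ≤1 a a′) (+-mono-≤ (δ≤1 b b′) (δ≤1 c c′))

  Gn-dist≤1 : ∀ {u v} → proj₁ u ≡ proj₁ v → proj₁ (proj₂ u) ≡ proj₁ (proj₂ v) → dist u v ≤ 1
  Gn-dist≤1 {a , b , c} {.a , .b , c′} refl refl =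
    +-mono-≤ (≤-reflexive (δ-refl a)) (+-mono-≤ (≤-reflexive (δ-refl b)) (δ≤1 c c′))

  Gn-dist≥3 : ∀ {u v} → 3 ≤ dist u v → proj₁ u ≢ proj₁ v × proj₁ (proj₂ u) ≢ proj₁ (proj₂ v)
  Gn-dist≥3 {a , b , c} {a′ , b′ , c′} 3≤dist =
      (λ { refl → ≤⇒≯ (+-mono-≤ (≤-reflexive (δ-refl a)) (+-mono-≤ (δ≤1 b b′) (δ≤1 c c′))) 3≤dist })
    , (λ { refl → ≤⇒≯ (+-mono-≤ (δ≤1 a a′) (+-mono-≤ (≤-reflexive (δ-refl b)) (δ≤1 c c′))) 3≤dist })

  -- The outer two of three consecutive labels both differ from the middle one in the two
  -- K₂-coordinates, so they agree there and are at distance ≤ 1 < 2.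
  Gn-noThreeConsecutive : ∀ {f} → RadioCondition 3 dist f → NoThreeConsecutive (λ t → ∃[ v ] f v ≡ t)
  Gn-noThreeConsecutive {f} rc (u , refl) (v , fv≡) (w , fw≡) =
    ≤⇒≯ (Gn-dist≤1 {u} {w} (≢-≢⇒≡ (proj₁ uv) (proj₁ vw)) (≢-≢⇒≡ (proj₂ uv) (proj₂ vw)))
        (+-cancelˡ-≤ 2 2 _ (gap 1 fw≡))
    where
    gap : ∀ {x y} t → f y ≡ suc t + f x → 4 ≤ suc t + dist x y
    gap {x} {y} t = radioCondition-gap {3} {f} {x} {y} t rc
    uv = Gn-dist≥3 {u} {v} (≤-pred (gap 0 fv≡))
    vw = Gn-dist≥3 {v} {w} (≤-pred (gap 0 (trans fw≡ (cong suc (sym fv≡)))))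

Gn-isDiam : ∀ m → IsDiam (Gn (suc (suc m))) 3
Gn-isDiam m =
  (λ u v → dist u v , Gn-dist≤3 u v , isDist u v) , (0F , 0F , 0F) , (1F , 1F , 1F) , isDist _ _
  where open GraphDistance (GnDistance (suc (suc m)))

vertexAt : ∀ {n} → Fin (2 * (2 * n)) → Vertex (Gn n)
vertexAt {n} i = map₂ (remQuot n) (remQuot (2 * n) i)

vertexAt-injective : ∀ {n} {i j : Fin (2 * (2 * n))} → vertexAt i ≡ vertexAt j → i ≡ j
vertexAt-injective {n} {i} {j} eq =
  trans (sym (index-vertexAt i)) (trans (cong index eq) (index-vertexAt j))
  where
  index : Vertex (Gn n) → Fin (2 * (2 * n))
  index (a , w) = combine a (uncurry combine w)
  index-vertexAt : ∀ i → index (vertexAt i) ≡ i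
  index-vertexAt i =
    trans (cong (combine a) (combine-remQuot {2} n r)) (combine-remQuot {2} (2 * n) i)
    where
    a = proj₁ (remQuot {2} (2 * n) i)
    r = proj₂ (remQuot {2} (2 * n) i)

6n∸1≡2+[2n-1]*3 : ∀ k → 6 * suc k ∸ 1 ≡ 2 + suc (k * 2) * 3
6n∸1≡2+[2n-1]*3 k = cong (_∸ 1) (lemma k)
  where
  lemma : ∀ k → 6 * suc k ≡ 3 + suc (k * 2) * 3
  lemma = solve-∀

4n≡2+[2n-1]*2 : ∀ k → 2 * (2 * suc k) ≡ 2 + suc (k * 2) * 2
4n≡2+[2n-1]*2 = solve-∀

Gn-span≥ : ∀ k {f} → (∀ v → 1 ≤ f v) → RadioCondition 3 (GraphDistance.dist (GnDistance (suc k))) f →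
           ∃[ v ] (6 * suc k ∸ 1 ≤ f v)
Gn-span≥ k {f} pos rc with any? (λ i → 6 * suc k ∸ 1 ≤? f (vertexAt i))
... | yes (i , large) = vertexAt i , large
... | no  noneLarge   = ⊥-elim (1+n≰n (≤-pred (subst (_≤ suc (q * 2)) (4n≡2+[2n-1]*2 k) tooMany)))
  where
  open GraphDistance (GnDistance (suc k))
  q = suc (k * 2)

  g : Fin (2 * (2 * suc k)) → ℕ
  g i = pred (f (vertexAt i))

  rc′ : RadioCondition 3 dist (pred ∘ f)
  rc′ = radioCondition-pred {D = 3} pos rc

  distinct : ∀ {i j} → i ≢ j → g i ≢ g j
  distinct i≢j =
    radioCondition₃-distinct {pred ∘ f} Gn-dist≤3 rc′ (λ eq → i≢j (vertexAt-injective eq))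

  noThree : NoThreeConsecutive (λ t → ∃[ i ] g i ≡ t)
  noThree (i , p) (j , p′) (l , p″) =
    Gn-noThreeConsecutive {f = pred ∘ f} rc′ (vertexAt i , p) (vertexAt j , p′) (vertexAt l , p″)

  g≤ : ∀ i → g i ≤ q * 3
  g≤ i = pred-mono-≤ (≤-pred (subst (f (vertexAt i) <_) (6n∸1≡2+[2n-1]*3 k)
                                (≰⇒> λ large → noneLarge (i , large))))

  tooMany : 2 * (2 * suc k) ≤ suc (q * 2)
  tooMany = noThreeConsecutive⇒≤ q g distinct noThree g≤

-- The labeling

-- Layer a of K₂ □ H receives the labels ≡ a + 1 (mod 3), ordered by τ a.  Labels one apart then
-- join the two layers at equal τ, labels two apart join τ 1F y to τ 0F x = τ 1F y + 1, and all other
-- pairs of labels are at least 3 apart.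
module TwoLayer {H : Graph} (dH : GraphDistance H) (τ : Fin 2 → Vertex H → ℕ)
                (τ-injective : ∀ a {x y} → τ a x ≡ τ a y → x ≡ y)
                (aligned : ∀ {x y} → τ 0F x ≡ τ 1F y → 2 ≤ GraphDistance.dist dH x y)
                (staggered : ∀ {x y} → τ 0F x ≡ suc (τ 1F y) → x ≢ y) where

  open GraphDistance (completeDistance 2 □ᵈ dH)
  private module H = GraphDistance dH

  label : Vertex (K 2 □ H) → ℕ
  label (a , x) = suc (toℕ a + τ a x * 3)

  toℕ<3 : (a : Fin 2) → toℕ a < 3
  toℕ<3 a = m<n⇒m<1+n (toℕ<n a)

  label-distinct : ∀ {u v} → u ≢ v → label u ≢ label v
  label-distinct {a , x} {b , y} u≢v eq
    with remainder-quotient-unique 3 {j = τ a x} {τ b y} (toℕ<3 a) (toℕ<3 b) (suc-injective eq)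
  ... | toℕa≡toℕb , τ≡ with toℕ-injective toℕa≡toℕb
  ... | refl = u≢v (cong (a ,_) (τ-injective a τ≡))

  label-gap₁ : ∀ {u v} → label v ≡ 1 + label u → 3 ≤ dist u v
  label-gap₁ {a , x} {b , y} eq
    with remainder-quotient-unique 3 {j = τ b y} {τ a x} (toℕ<3 b) (s≤s (toℕ<n a)) (suc-injective eq)
  label-gap₁ {0F , x} {1F , y} eq | _ , τ≡ = s≤s (aligned (sym τ≡))
  label-gap₁ {0F , x} {0F , y} eq | () , _
  label-gap₁ {1F , x} {0F , y} eq | () , _
  label-gap₁ {1F , x} {1F , y} eq | () , _

  label-gap₂ : ∀ {u v} → label v ≡ 2 + label u → 2 ≤ dist u v
  label-gap₂ {0F , x} {b , y} eq
    with remainder-quotient-unique 3 {j = τ b y} {τ 0F x} (toℕ<3 b) ≤-refl (suc-injective eq)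
  ... | toℕb≡2 , _ = ⊥-elim (<⇒≢ (toℕ<n b) toℕb≡2)
  label-gap₂ {1F , x} {b , y} eq
    with remainder-quotient-unique 3 {j = τ b y} {suc (τ 1F x)} (toℕ<3 b) (s≤s z≤n) (suc-injective eq)
  label-gap₂ {1F , x} {0F , y} eq | _ , τ≡ = s≤s (H.dist-pos (≢-sym (staggered τ≡)))
  label-gap₂ {1F , x} {1F , y} eq | () , _

  label-radioCondition : RadioCondition 3 dist label
  label-radioCondition = radioCondition₃ label-distinct label-gap₁ label-gap₂

  label-span : ∀ {q} → (∀ a x → τ a x ≤ q) → ∀ {x} → τ 1F x ≡ q → HasSpan (K 2 □ H) label (2 + q * 3)
  label-span τ≤ {x} τ≡q =
      (λ (a , y) → s≤s (+-mono-≤ (s≤s⁻¹ (toℕ<n a)) (*-monoˡ-≤ 3 (τ≤ a y))))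
    , (1F , x) , cong (λ t → 2 + t * 3) τ≡q

δ-injectiveˡ : ∀ {b b′ z : Fin 2} → δ b z ≡ δ b′ z → b ≡ b′
δ-injectiveˡ {b} {b′} {z} eq with b ≟ z | b′ ≟ z
... | yes refl | yes refl = refl
... | no b≢z   | no b′≢z  = ≢-≢⇒≡ b≢z (≢-sym b′≢z)
δ-injectiveˡ () | yes _ | no _
δ-injectiveˡ () | no _  | yes _

δ≡δ⇒≢ : ∀ {b b′ z z′ : Fin 2} → δ b z ≡ δ b′ z′ → z ≢ z′ → b ≢ b′
δ≡δ⇒≢ {b} {.b} {z} {z′} eq z≢z′ refl with b ≟ z | b ≟ z′
... | yes refl | yes refl = z≢z′ refl
... | no b≢z   | no b≢z′  = z≢z′ (≢-≢⇒≡ (≢-sym b≢z) b≢z′)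
δ≡δ⇒≢ () z≢z′ refl | yes _ | no _
δ≡δ⇒≢ () z≢z′ refl | no _  | yes _

parity : ℕ → Fin 2
parity 0             = 0F
parity 1             = 1F
parity (suc (suc k)) = parity k

parity-suc : ∀ k → parity (suc k) ≢ parity k
parity-suc 0             ()
parity-suc 1             ()
parity-suc (suc (suc k)) = parity-suc k

module LayerOrder (m : ℕ) where
  private
    n = suc (suc m)
    module H = GraphDistance (completeDistance 2 □ᵈ completeDistance n)

  cyclicPred : Fin n → ℕ
  cyclicPred 0F           = suc m
  cyclicPred (Fin.suc c)  = toℕ c

  cyclicPred-injective : ∀ {c c′} → cyclicPred c ≡ cyclicPred c′ → c ≡ c′
  cyclicPred-injective {0F}        {0F}         _  = refl
  cyclicPred-injective {0F}        {Fin.suc c′} eq = ⊥-elim (<⇒≢ (toℕ<n c′) (sym eq))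
  cyclicPred-injective {Fin.suc c} {0F}         eq = ⊥-elim (<⇒≢ (toℕ<n c) eq)
  cyclicPred-injective {Fin.suc c} {Fin.suc c′} eq = cong Fin.suc (toℕ-injective eq)

  toℕ≢cyclicPred : ∀ c → toℕ c ≢ cyclicPred c
  toℕ≢cyclicPred 0F          ()
  toℕ≢cyclicPred (Fin.suc c) = 1+n≢n

  position : Fin 2 → Fin n → ℕ
  position 0F = toℕ
  position 1F = cyclicPred

  position-injective : ∀ a {c c′} → position a c ≡ position a c′ → c ≡ c′
  position-injective 0F = toℕ-injective
  position-injective 1F = cyclicPred-injective

  position≤ : ∀ a c → position a c ≤ suc m
  position≤ 0F c           = s≤s⁻¹ (toℕ<n c)
  position≤ 1F 0F          = ≤-refl
  position≤ 1F (Fin.suc c) = <⇒≤ (toℕ<n c)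

  -- The parity twist is what makes τ staggered even for n = 2.
  τ : Fin 2 → Vertex (K 2 □ K n) → ℕ
  τ a (b , c) = δ b (parity (toℕ a + position a c)) + position a c * 2

  τ-injective : ∀ a {x y} → τ a x ≡ τ a y → x ≡ y
  τ-injective a {b , c} {b′ , c′} eq
    with remainder-quotient-unique 2 {j = position a c} {position a c′} (δ<2 _ _) (δ<2 _ _) eq
  ... | δ≡ , p≡ with position-injective a p≡
  ... | refl = cong (_, c) (δ-injectiveˡ δ≡)

  τ-aligned : ∀ {x y} → τ 0F x ≡ τ 1F y → 2 ≤ H.dist x y
  τ-aligned {b , c} {b′ , c′} eq
    with remainder-quotient-unique 2 {j = toℕ c} {cyclicPred c′} (δ<2 _ _) (δ<2 _ _) eq
  ... | δ≡ , p≡ = ≤-reflexive (sym (cong₂ _+_ (δ-≢ b≢b′) (δ-≢ c≢c′)))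
    where
    c≢c′ : c ≢ c′
    c≢c′ refl = toℕ≢cyclicPred c p≡
    b≢b′ : b ≢ b′
    b≢b′ = δ≡δ⇒≢ δ≡ (subst (λ p → parity p ≢ parity (suc (cyclicPred c′))) (sym p≡)
                          (≢-sym (parity-suc (cyclicPred c′))))

  τ-staggered : ∀ {x y} → τ 0F x ≡ suc (τ 1F y) → x ≢ y
  τ-staggered {b , c} eq refl with b ≟ parity (suc (cyclicPred c))
  ... | yes _ = toℕ≢cyclicPred c (proj₂ (remainder-quotient-unique 2 {b = 1} {toℕ c} {cyclicPred c}
                                           (δ<2 _ _) ≤-refl eq))
  ... | no b≢ with remainder-quotient-unique 2 {j = toℕ c} {suc (cyclicPred c)} (δ<2 _ _) (s≤s z≤n) eq
  ...   | δ≡0 , p≡ = b≢ (trans (δ≡0⇒≡ δ≡0) (cong parity p≡))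

  τ≤ : ∀ a x → τ a x ≤ suc (suc m * 2)
  τ≤ a (b , c) = +-mono-≤ (δ≤1 _ _) (*-monoˡ-≤ 2 (position≤ a c))

  τ-top : τ 1F (parity (suc m) , 0F) ≡ suc (suc m * 2)
  τ-top = cong (_+ suc m * 2) (δ-≢ (≢-sym (parity-suc (suc m))))

Gn-radioLabeling : ∀ m → ∃[ f ] (IsRadioLabeling (Gn (suc (suc m))) 3 f
                                  × HasSpan (Gn (suc (suc m))) f (6 * suc (suc m) ∸ 1))
Gn-radioLabeling m =
    label
  , radioCondition⇒isRadioLabeling {3} (λ _ → s≤s z≤n) label-radioCondition
  , subst (HasSpan (Gn (suc (suc m))) label) (sym (6n∸1≡2+[2n-1]*3 (suc m)))
          (label-span τ≤ {parity (suc m) , 0F} τ-top)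
  where
  open GraphDistance (GnDistance (suc (suc m)))
  open LayerOrder m
  open TwoLayer (completeDistance 2 □ᵈ completeDistance (suc (suc m))) τ τ-injective
                (λ {x} {y} → τ-aligned {x} {y}) (λ {x} {y} → τ-staggered {x} {y})

mainTheorem13 : (n : ℕ) → 2 ≤ n →
    (∃[ D ] IsDiam (Gn n) D) × (∀ D → IsDiam (Gn n) D → IsRadioNumber (Gn n) D (6 * n ∸ 1))
mainTheorem13 n@(suc (suc m)) (s≤s (s≤s _)) =
  (3 , Gn-isDiam m) , λ D isDiam → subst (λ D → IsRadioNumber (Gn n) D (6 * n ∸ 1))
                                         (isDiam-unique (Gn-isDiam m) isDiam) radioNumber
  where
  open GraphDistance (GnDistance n)
  radioNumber : IsRadioNumber (Gn n) 3 (6 * n ∸ 1)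
  radioNumber = Gn-radioLabeling m
              , λ f isRL → Gn-span≥ (suc m) (proj₁ isRL) (isRadioLabeling⇒radioCondition {3} isRL)
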